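{- Let $R=(r_1,\ldots,r_m)$ and $S=(s_1,\ldots,s_n)$ be nonnegative integral vectors with $r_1+\cdots+r_m=s_1+\cdots+s_n$, and assume $S$ is nonincreasing. Then $\mathcal{A}^{\pm}(R,S)\neq\emptyset$ if and only if $$\sum_{j=1}^k s_j\le \sum_{i=1}^m \min\{r_i+n,\,2k\}-km\qquad (k=1,2,\ldots,n).$$
   Context: $\mathcal{A}^{\pm}(R,S)$ denotes the set of all $m\times n$ matrices with entries in $\{0,1,-1\}$ having row sum vector $R$ and column sum vector $S$. -}

module Defs where

open import Data.Nat using (ℕ; zero; suc; _⊓_; _≤_)
open import Data.Fin using (Fin; zero; suc; toℕ)
open import Data.Integer as ℤ using (ℤ; +_)
open import Data.Product using (Σ; _×_)
open import Data.Sum using (_⊎_)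
open import Relation.Binary.PropositionalEquality using (_≡_)

sumℕ : (n : ℕ) → (Fin n → ℕ) → ℕ
sumℕ zero    f = 0
sumℕ (suc n) f = f zero Data.Nat.+ sumℕ n (λ i → f (suc i))

sumℤ : (n : ℕ) → (Fin n → ℤ) → ℤ
sumℤ zero    f = + 0
sumℤ (suc n) f = f zero ℤ.+ sumℤ n (λ i → f (suc i))

-- sum of the first k entries s_1 + ... + s_k of S (entries with index < k)
prefixSum : {n : ℕ} → ℕ → (Fin n → ℕ) → ℕ
prefixSum {zero}  k       S = 0
prefixSum {suc n} zero    S = 0
prefixSum {suc n} (suc k) S = S zero Data.Nat.+ prefixSum k (λ i → S (suc i))

IsSignEntry : ℤ → Set
IsSignEntry x = x ≡ + 0 ⊎ (x ≡ + 1 ⊎ x ≡ ℤ.- (+ 1))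

Nonincreasing : {n : ℕ} → (Fin n → ℕ) → Set
Nonincreasing {n} S = (i j : Fin n) → toℕ i ≤ toℕ j → S j ≤ S i

InAPM : {m n : ℕ} → (Fin m → ℕ) → (Fin n → ℕ) → (Fin m → Fin n → ℤ) → Set
InAPM {m} {n} R S A =
  ((i : Fin m) (j : Fin n) → IsSignEntry (A i j)) ×
  (((i : Fin m) → sumℤ n (λ j → A i j) ≡ + R i) ×
   ((j : Fin n) → sumℤ m (λ i → A i j) ≡ + S j))

APMNonempty : {m n : ℕ} → (Fin m → ℕ) → (Fin n → ℕ) → Set
APMNonempty {m} {n} R S = Σ (Fin m → Fin n → ℤ) (λ A → InAPM R S A)

-- Adding 1 to every entry identifies 𝒜^±(R,S) with the matrices with entries in {0,1,2},
-- row sums a_i = r_i + n and column sums b_j = s_j + m, and turns the displayed inequality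
-- into the capacity-2 Gale–Ryser condition  b_1 + ⋯ + b_k ≤ Σ_i min(a_i, 2k).
-- For a capacity c, necessity holds because the first k entries of row i sum to at most
-- min(a_i, ck).  For sufficiency, fill every row greedily from the left (c, …, c, rest, 0, …);
-- its column sums dominate b prefix-wise.  While the first column sum exceeds b_1, let l be
-- the first column with a deficit: since b is nonincreasing, column l has a smaller sum than
-- column 1, so some row has a smaller entry in column l, and moving one unit of that row from
-- column 1 to column l keeps the capacity, the row sums and the dominance.  Once the first
-- column is exact, delete it and recurse.
module Submission where

open import Defs
open import Algebra.Bundles using (AbelianGroup)
open import Data.Nat using (ℕ; zero; suc; _+_; _*_; _∸_; _⊓_; _≤_; _<_; z≤n; s≤s; _≤?_; _<?_)
open import Data.Nat.Properties
open import Data.Fin using (Fin; zero; suc; toℕ; fromℕ<)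
open import Data.Fin.Properties using (¬∀⟶∃¬; ¬∀⟶∃¬-smallest; toℕ-injective; toℕ-inject; toℕ-fromℕ<)
import Data.Integer as ℤ
import Data.Integer.Properties as ℤP
open import Data.Product using (∃; ∃-syntax; _×_; _,_; proj₁; proj₂; map₂)
open import Data.Sum using (_⊎_; inj₁; inj₂)
open import Data.Vec.Functional using (_∷_)
open import Function.Base using (_∘_)
open import Function.Bundles using (_⇔_; mk⇔; Equivalence)
open import Function.Construct.Composition using (_⇔-∘_)
open import Relation.Nullary using (Dec; yes; no; ¬_)
open import Relation.Nullary.Negation using (contradiction)
open import Relation.Binary.PropositionalEquality
open import Algebra.Properties.Semiring.Sum +-*-semiring
  using (sum; sum-cong-≗; ∑-distrib-+; *-distribˡ-sum; *-distribʳ-sum; sum-replicate-zero)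
open import Algebra.Properties.CommutativeSemigroup +-commutativeSemigroup using (interchange)
import Algebra.Properties.CommutativeSemigroup ℤP.+-commutativeSemigroup as ℤ+
open import Algebra.Properties.Group (AbelianGroup.group ℤP.+-0-abelianGroup)
  using (∙-cancelʳ; //-rightDividesˡ; //-rightDividesʳ)

Matrix : ℕ → ℕ → Set
Matrix m n = Fin m → Fin n → ℕ

module _ {m n : ℕ} where

  rowSums : Matrix m n → Fin m → ℕ
  rowSums M i = sum (M i)

  colSums : Matrix m n → Fin n → ℕ
  colSums M j = sum (λ i → M i j)

  Bounded : ℕ → Matrix m n → Set
  Bounded c M = ∀ i j → M i j ≤ c

  Realizes : ℕ → (Fin m → ℕ) → (Fin n → ℕ) → Matrix m n → Set
  Realizes c a b M = Bounded c M × rowSums M ≗ a × colSums M ≗ b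

  realizable-cong-rows : ∀ {c a a′ b} → a ≗ a′ → ∃ (Realizes c a b) → ∃ (Realizes c a′ b)
  realizable-cong-rows a≗a′ (M , bounded , rows , cols) = M , bounded , (λ i → trans (rows i) (a≗a′ i)) , cols

_≼_ : ∀ {n} → (Fin n → ℕ) → (Fin n → ℕ) → Set
_≼_ {n} b c = ∀ k → k ≤ n → prefixSum k b ≤ prefixSum k c

Dominant : ∀ {m n} → ℕ → (Fin n → ℕ) → Matrix m n → Set
Dominant c b M = Bounded c M × sum (colSums M) ≡ sum b × b ≼ colSums M

sumℕ≡sum : ∀ n (f : Fin n → ℕ) → sumℕ n f ≡ sum f
sumℕ≡sum zero    f = refl
sumℕ≡sum (suc n) f = cong (f zero +_) (sumℕ≡sum n (f ∘ suc))

sum-const : ∀ n c → sum {n} (λ _ → c) ≡ n * c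
sum-const zero    c = refl
sum-const (suc n) c = cong (c +_) (sum-const n c)

sum-+-const : ∀ {n} (f : Fin n → ℕ) c → sum (λ j → f j + c) ≡ sum f + n * c
sum-+-const {n} f c = trans (∑-distrib-+ f (λ _ → c)) (cong (sum f +_) (sum-const n c))

sum-+-cong : ∀ {n} (f g f′ g′ : Fin n → ℕ) → (∀ j → f j + g j ≡ f′ j + g′ j) →
             sum f + sum g ≡ sum f′ + sum g′
sum-+-cong f g f′ g′ eq = begin
  sum f + sum g                ≡⟨ ∑-distrib-+ f g ⟨
  sum (λ j → f j + g j)        ≡⟨ sum-cong-≗ eq ⟩
  sum (λ j → f′ j + g′ j)      ≡⟨ ∑-distrib-+ f′ g′ ⟩
  sum f′ + sum g′              ∎
  where open ≡-Reasoning

sum-mono-≤ : ∀ {n} {f g : Fin n → ℕ} → (∀ i → f i ≤ g i) → sum f ≤ sum g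
sum-mono-≤ {zero}  f≤g = z≤n
sum-mono-≤ {suc n} f≤g = +-mono-≤ (f≤g zero) (sum-mono-≤ (f≤g ∘ suc))

sum-mono-< : ∀ {n} {f g : Fin n → ℕ} → (∀ i → f i ≤ g i) → ∀ i → f i < g i → sum f < sum g
sum-mono-< f≤g zero    f₀<g₀ = +-mono-<-≤ f₀<g₀ (sum-mono-≤ (f≤g ∘ suc))
sum-mono-< f≤g (suc i) fᵢ<gᵢ = +-mono-≤-< (f≤g zero) (sum-mono-< (f≤g ∘ suc) i fᵢ<gᵢ)

sum-<⇒∃< : ∀ {n} {f g : Fin n → ℕ} → sum f < sum g → ∃[ i ] f i < g i
sum-<⇒∃< {n} {f} {g} Σf<Σg = map₂ ≰⇒> (¬∀⟶∃¬ n (λ i → g i ≤ f i) (λ i → g i ≤? f i)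
  (λ g≤f → <⇒≱ Σf<Σg (sum-mono-≤ g≤f)))

≤∧sum-≥⇒≗ : ∀ {n} {f g : Fin n → ℕ} → (∀ i → f i ≤ g i) → sum g ≤ sum f → f ≗ g
≤∧sum-≥⇒≗ f≤g Σg≤Σf i = ≤-antisym (f≤g i) (≮⇒≥ λ fᵢ<gᵢ → <⇒≱ (sum-mono-< f≤g i fᵢ<gᵢ) Σg≤Σf)

prefixSum-0 : ∀ {n} (f : Fin n → ℕ) → prefixSum 0 f ≡ 0
prefixSum-0 {zero}  f = refl
prefixSum-0 {suc n} f = refl

prefixSum-cong : ∀ {n} k {f g : Fin n → ℕ} → f ≗ g → prefixSum k f ≡ prefixSum k g
prefixSum-cong {zero}  k       f≗g = refl
prefixSum-cong {suc n} zero    f≗g = refl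
prefixSum-cong {suc n} (suc k) f≗g = cong₂ _+_ (f≗g zero) (prefixSum-cong k (f≗g ∘ suc))

prefixSum-+ : ∀ {n} k (f g : Fin n → ℕ) →
              prefixSum k (λ j → f j + g j) ≡ prefixSum k f + prefixSum k g
prefixSum-+ {zero}  k       f g = refl
prefixSum-+ {suc n} zero    f g = refl
prefixSum-+ {suc n} (suc k) f g = begin
  (f zero + g zero) + prefixSum k (λ j → f (suc j) + g (suc j))       ≡⟨ cong (f zero + g zero +_) (prefixSum-+ k (f ∘ suc) (g ∘ suc)) ⟩
  (f zero + g zero) + (prefixSum k (f ∘ suc) + prefixSum k (g ∘ suc)) ≡⟨ interchange (f zero) (g zero) _ _ ⟩
  (f zero + prefixSum k (f ∘ suc)) + (g zero + prefixSum k (g ∘ suc)) ∎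
  where open ≡-Reasoning

prefixSum-+-cong : ∀ {n} k (f g f′ g′ : Fin n → ℕ) → (∀ j → f j + g j ≡ f′ j + g′ j) →
                   prefixSum k f + prefixSum k g ≡ prefixSum k f′ + prefixSum k g′
prefixSum-+-cong k f g f′ g′ eq = begin
  prefixSum k f + prefixSum k g        ≡⟨ prefixSum-+ k f g ⟨
  prefixSum k (λ j → f j + g j)        ≡⟨ prefixSum-cong k eq ⟩
  prefixSum k (λ j → f′ j + g′ j)      ≡⟨ prefixSum-+ k f′ g′ ⟩
  prefixSum k f′ + prefixSum k g′      ∎
  where open ≡-Reasoning

prefixSum-const : ∀ {n} k c → k ≤ n → prefixSum {n} k (λ _ → c) ≡ k * c
prefixSum-const {zero}  zero    c _         = refl
prefixSum-const {suc n} zero    c _         = refl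
prefixSum-const {suc n} (suc k) c (s≤s k≤n) = cong (c +_) (prefixSum-const k c k≤n)

prefixSum-+-const : ∀ {n} k (f : Fin n → ℕ) c → k ≤ n → prefixSum k (λ j → f j + c) ≡ prefixSum k f + k * c
prefixSum-+-const k f c k≤n = trans (prefixSum-+ k f (λ _ → c)) (cong (prefixSum k f +_) (prefixSum-const k c k≤n))

prefixSum-full : ∀ {n} (f : Fin n → ℕ) → prefixSum n f ≡ sum f
prefixSum-full {zero}  f = refl
prefixSum-full {suc n} f = cong (f zero +_) (prefixSum-full (f ∘ suc))

prefixSum≤sum : ∀ {n} k (f : Fin n → ℕ) → prefixSum k f ≤ sum f
prefixSum≤sum {zero}  k       f = z≤n
prefixSum≤sum {suc n} zero    f = z≤n
prefixSum≤sum {suc n} (suc k) f = +-monoʳ-≤ (f zero) (prefixSum≤sum k (f ∘ suc))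

prefixSum-zeros : ∀ {n} k → prefixSum {n} k (λ _ → 0) ≡ 0
prefixSum-zeros {n} k =
  n≤0⇒n≡0 (subst (prefixSum {n} k (λ _ → 0) ≤_) (sum-replicate-zero n) (prefixSum≤sum {n} k (λ _ → 0)))

prefixSum-mono-≤ : ∀ {n} k {f g : Fin n → ℕ} → (∀ j → toℕ j < k → f j ≤ g j) →
                   prefixSum k f ≤ prefixSum k g
prefixSum-mono-≤ {zero}  k       f≤g = z≤n
prefixSum-mono-≤ {suc n} zero    f≤g = z≤n
prefixSum-mono-≤ {suc n} (suc k) f≤g =
  +-mono-≤ (f≤g zero (s≤s z≤n)) (prefixSum-mono-≤ k (λ j j<k → f≤g (suc j) (s≤s j<k)))

prefixSum-≤-* : ∀ {n} k {c} {f : Fin n → ℕ} → (∀ j → f j ≤ c) → prefixSum k f ≤ c * k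
prefixSum-≤-* {zero}  k       f≤c = z≤n
prefixSum-≤-* {suc n} zero    f≤c = z≤n
prefixSum-≤-* {suc n} (suc k) {c} {f} f≤c =
  subst (f zero + prefixSum k (f ∘ suc) ≤_) (sym (*-suc c k)) (+-mono-≤ (f≤c zero) (prefixSum-≤-* k (f≤c ∘ suc)))

prefixSum-colSums : ∀ {m n} k (M : Matrix m n) →
                    prefixSum k (colSums M) ≡ sum (λ i → prefixSum k (M i))
prefixSum-colSums {m} {zero}  k       M = sym (sum-replicate-zero m)
prefixSum-colSums {m} {suc n} zero    M = sym (sum-replicate-zero m)
prefixSum-colSums {m} {suc n} (suc k) M = begin
  colSums M zero + prefixSum k (colSums (λ i → M i ∘ suc))      ≡⟨ cong (colSums M zero +_) (prefixSum-colSums k (λ i → M i ∘ suc)) ⟩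
  sum (λ i → M i zero) + sum (λ i → prefixSum k (M i ∘ suc))    ≡⟨ ∑-distrib-+ (λ i → M i zero) _ ⟨
  sum (λ i → M i zero + prefixSum k (M i ∘ suc))                ∎
  where open ≡-Reasoning

≼-head : ∀ {n} {b c : Fin (suc n) → ℕ} → b ≼ c → b zero ≤ c zero
≼-head {n} {b} {c} b≼c = subst₂ _≤_ (eq b) (eq c) (b≼c 1 (s≤s z≤n))
  where
  eq : (f : Fin (suc n) → ℕ) → prefixSum 1 f ≡ f zero
  eq f = trans (cong (f zero +_) (prefixSum-0 (f ∘ suc))) (+-identityʳ (f zero))

≼-tail : ∀ {n} {b c : Fin (suc n) → ℕ} → b zero ≡ c zero → b ≼ c → (b ∘ suc) ≼ (c ∘ suc)
≼-tail {b = b} {c} b₀≡c₀ b≼c k k≤n = +-cancelˡ-≤ (b zero) _ _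
  (subst (λ x → b zero + prefixSum k (b ∘ suc) ≤ x + prefixSum k (c ∘ suc)) (sym b₀≡c₀)
         (b≼c (suc k) (s≤s k≤n)))

firstDeficit : ∀ {n} (b c : Fin n → ℕ) → ¬ (∀ j → b j ≤ c j) →
               ∃[ l ] c l < b l × (∀ t → toℕ t < toℕ l → b t ≤ c t)
firstDeficit {n} b c b≰c with ¬∀⟶∃¬-smallest n (λ j → b j ≤ c j) (λ j → b j ≤? c j) b≰c
... | l , bₗ≰cₗ , b≤c-before = l , ≰⇒> bₗ≰cₗ , λ t t<l →
  subst (λ u → b u ≤ c u) (toℕ-injective (trans (toℕ-inject (fromℕ< t<l)) (toℕ-fromℕ< t<l)))
        (b≤c-before (fromℕ< t<l))

Nonincreasing-tail : ∀ {n} {b : Fin (suc n) → ℕ} → Nonincreasing b → Nonincreasing (b ∘ suc)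
Nonincreasing-tail b↓ i j i≤j = b↓ (suc i) (suc j) (s≤s i≤j)

-- Moving a unit within a row

δ : ∀ {n} → Fin n → Fin n → ℕ
δ zero    zero    = 1
δ zero    (suc j) = 0
δ (suc i) zero    = 0
δ (suc i) (suc j) = δ i j

δ-diag : ∀ {n} (i : Fin n) → δ i i ≡ 1
δ-diag zero    = refl
δ-diag (suc i) = δ-diag i

δ-cases : ∀ {n} (i j : Fin n) → δ i j ≡ 0 ⊎ i ≡ j
δ-cases zero    zero    = inj₂ refl
δ-cases zero    (suc j) = inj₁ refl
δ-cases (suc i) zero    = inj₁ refl
δ-cases (suc i) (suc j) = Data.Sum.map₂ (cong suc) (δ-cases i j)

sum-δ : ∀ {n} (i : Fin n) → sum (δ i) ≡ 1
sum-δ {suc n} zero    = cong suc (sum-replicate-zero n)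
sum-δ         (suc i) = sum-δ i

prefixSum-δ-≤ : ∀ {n} (l : Fin n) k → k ≤ toℕ l → prefixSum k (δ l) ≡ 0
prefixSum-δ-≤ l       zero    _         = prefixSum-0 (δ l)
prefixSum-δ-≤ (suc l) (suc k) (s≤s k≤l) = prefixSum-δ-≤ l k k≤l

prefixSum-δ-> : ∀ {n} (l : Fin n) k → toℕ l < k → prefixSum k (δ l) ≡ 1
prefixSum-δ-> {suc n} zero (suc k) _     = cong suc (prefixSum-zeros {n} k)
prefixSum-δ-> (suc l) (suc k) (s≤s l<k) = prefixSum-δ-> l k l<k

unit : ∀ {m n} → Fin m → Fin n → Matrix m n
unit i j r s = δ i r * δ j s

rowSums-unit : ∀ {m n} (i : Fin m) (j : Fin n) r → rowSums (unit i j) r ≡ δ i r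
rowSums-unit i j r = begin
  sum (λ s → δ i r * δ j s)  ≡⟨ *-distribˡ-sum (δ i r) (δ j) ⟨
  δ i r * sum (δ j)          ≡⟨ cong (δ i r *_) (sum-δ j) ⟩
  δ i r * 1                  ≡⟨ *-identityʳ (δ i r) ⟩
  δ i r                      ∎
  where open ≡-Reasoning

colSums-unit : ∀ {m n} (i : Fin m) (j : Fin n) s → colSums (unit i j) s ≡ δ j s
colSums-unit i j s = begin
  sum (λ r → δ i r * δ j s)  ≡⟨ *-distribʳ-sum (δ j s) (δ i) ⟨
  sum (δ i) * δ j s          ≡⟨ cong (_* δ j s) (sum-δ i) ⟩
  1 * δ j s                  ≡⟨ *-identityˡ (δ j s) ⟩
  δ j s                      ∎
  where open ≡-Reasoning

unit-cases : ∀ {m n} (i r : Fin m) (j s : Fin n) → unit i j r s ≡ 0 ⊎ (i ≡ r × j ≡ s)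
unit-cases i r j s with δ-cases i r | δ-cases j s
... | inj₁ δᵢᵣ≡0 | _           = inj₁ (cong (_* δ j s) δᵢᵣ≡0)
... | inj₂ _     | inj₁ δⱼₛ≡0 = inj₁ (trans (cong (δ i r *_) δⱼₛ≡0) (*-zeroʳ (δ i r)))
... | inj₂ i≡r   | inj₂ j≡s    = inj₂ (i≡r , j≡s)

unit-diag : ∀ {m n} (i : Fin m) (j : Fin n) → unit i j i j ≡ 1
unit-diag i j = cong₂ _*_ (δ-diag i) (δ-diag j)

moveUnit : ∀ {m n} → Matrix m n → Fin m → Fin n → Fin n → Matrix m n
moveUnit M i j₁ j₂ r s = M r s + unit i j₂ r s ∸ unit i j₁ r s

transferUnit : ∀ {m n c} {M : Matrix m n} → Bounded c M → ∀ i j₁ j₂ → M i j₂ < M i j₁ →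
  ∃[ M′ ] Bounded c M′ × rowSums M′ ≗ rowSums M ×
          (∀ s → colSums M′ s + δ j₁ s ≡ colSums M s + δ j₂ s)
transferUnit {c = c} {M} bounded i j₁ j₂ Mᵢⱼ₂<Mᵢⱼ₁ = M′ , bounded′ , rows , cols
  where
  open ≤-Reasoning
  M′ = moveUnit M i j₁ j₂

  unit≤M : ∀ r s → unit i j₁ r s ≤ M r s
  unit≤M r s with unit-cases i r j₁ s
  ... | inj₁ e             = subst (_≤ M r s) (sym e) z≤n
  ... | inj₂ (refl , refl) = subst (_≤ M i j₁) (sym (unit-diag i j₁)) (≤-trans (s≤s z≤n) Mᵢⱼ₂<Mᵢⱼ₁)

  balance : ∀ r s → M′ r s + unit i j₁ r s ≡ M r s + unit i j₂ r s
  balance r s = m∸n+n≡m (≤-trans (unit≤M r s) (m≤m+n (M r s) _))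

  bounded′ : Bounded c M′
  bounded′ r s with unit-cases i r j₂ s
  ... | inj₁ e = ≤-trans (m∸n≤m (M r s + unit i j₂ r s) (unit i j₁ r s)) (begin
    M r s + unit i j₂ r s   ≡⟨ cong (M r s +_) e ⟩
    M r s + 0               ≡⟨ +-identityʳ (M r s) ⟩
    M r s                   ≤⟨ bounded r s ⟩
    c                       ∎)
  ... | inj₂ (refl , refl) = ≤-trans (m∸n≤m (M i j₂ + unit i j₂ i j₂) (unit i j₁ i j₂)) (begin
    M i j₂ + unit i j₂ i j₂ ≡⟨ cong (M i j₂ +_) (unit-diag i j₂) ⟩
    M i j₂ + 1              ≡⟨ +-comm (M i j₂) 1 ⟩
    suc (M i j₂)            ≤⟨ Mᵢⱼ₂<Mᵢⱼ₁ ⟩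
    M i j₁                  ≤⟨ bounded i j₁ ⟩
    c                       ∎)

  rows : rowSums M′ ≗ rowSums M
  rows r = +-cancelʳ-≡ (δ i r) _ _ (begin-equality
    rowSums M′ r + δ i r                  ≡⟨ cong (rowSums M′ r +_) (rowSums-unit i j₁ r) ⟨
    rowSums M′ r + rowSums (unit i j₁) r  ≡⟨ sum-+-cong (M′ r) (unit i j₁ r) (M r) (unit i j₂ r) (balance r) ⟩
    rowSums M r + rowSums (unit i j₂) r   ≡⟨ cong (rowSums M r +_) (rowSums-unit i j₂ r) ⟩
    rowSums M r + δ i r                   ∎)

  cols : ∀ s → colSums M′ s + δ j₁ s ≡ colSums M s + δ j₂ s
  cols s = begin-equality
    colSums M′ s + δ j₁ s                 ≡⟨ cong (colSums M′ s +_) (colSums-unit i j₁ s) ⟨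
    colSums M′ s + colSums (unit i j₁) s  ≡⟨ sum-+-cong (λ r → M′ r s) (λ r → unit i j₁ r s) (λ r → M r s) (λ r → unit i j₂ r s) (λ r → balance r s) ⟩
    colSums M s + colSums (unit i j₂) s   ≡⟨ cong (colSums M s +_) (colSums-unit i j₂ s) ⟩
    colSums M s + δ j₂ s                  ∎

≼-transfer : ∀ {n} {b col col′ : Fin (suc n) → ℕ} (l : Fin (suc n)) →
  (∀ s → col′ s + δ zero s ≡ col s + δ l s) →
  b zero < col zero → (∀ t → toℕ t < toℕ l → b t ≤ col t) → b ≼ col → b ≼ col′
≼-transfer             l balance b₀<c₀ b≤c-before b≼col zero    _   = z≤n
≼-transfer {n} {b} {col} {col′} l balance b₀<c₀ b≤c-before b≼col (suc k) k≤n =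
  +-cancelʳ-≤ 1 _ _ (begin
    prefixSum (suc k) b + 1                          ≤⟨ bound (toℕ l <? suc k) ⟩
    prefixSum (suc k) col + prefixSum (suc k) (δ l)  ≡⟨ shifted ⟨
    prefixSum (suc k) col′ + 1                       ∎)
  where
  open ≤-Reasoning
  shifted : prefixSum (suc k) col′ + 1 ≡ prefixSum (suc k) col + prefixSum (suc k) (δ l)
  shifted = trans (cong (prefixSum (suc k) col′ +_) (sym (prefixSum-δ-> {suc n} zero (suc k) (s≤s z≤n))))
                  (prefixSum-+-cong (suc k) col′ (δ zero) col (δ l) balance)

  b≤c-tail : suc k ≤ toℕ l → ∀ t → toℕ t < k → b (suc t) ≤ col (suc t)
  b≤c-tail k<l t t<k = b≤c-before (suc t) (<-≤-trans (s≤s t<k) k<l)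

  bound : Dec (toℕ l < suc k) → prefixSum (suc k) b + 1 ≤ prefixSum (suc k) col + prefixSum (suc k) (δ l)
  bound (yes l<k) = +-mono-≤ (b≼col (suc k) k≤n) (≤-reflexive (sym (prefixSum-δ-> l (suc k) l<k)))
  -- up to column l the prefix sums of col′ lose a unit; the surplus b₀ < col₀ absorbs it
  bound (no l≮k)  = begin
    prefixSum (suc k) b + 1                          ≡⟨ +-comm _ 1 ⟩
    suc (prefixSum (suc k) b)                        ≤⟨ +-mono-<-≤ b₀<c₀ (prefixSum-mono-≤ k (b≤c-tail (≮⇒≥ l≮k))) ⟩
    prefixSum (suc k) col                            ≡⟨ +-identityʳ _ ⟨
    prefixSum (suc k) col + 0                        ≡⟨ cong (prefixSum (suc k) col +_) (prefixSum-δ-≤ l (suc k) (≮⇒≥ l≮k)) ⟨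
    prefixSum (suc k) col + prefixSum (suc k) (δ l)  ∎

-- Capacitated Gale–Ryser theorem

Dominant-tail : ∀ {m n c} {b : Fin (suc n) → ℕ} {M : Matrix m (suc n)} →
  Dominant c b M → colSums M zero ≡ b zero → Dominant c (b ∘ suc) (λ i → M i ∘ suc)
Dominant-tail {b = b} {M} (bounded , Σ≡ , b≼) c₀≡b₀ =
  (λ i → bounded i ∘ suc) ,
  +-cancelˡ-≡ (b zero) _ _ (subst (λ x → x + sum (colSums M ∘ suc) ≡ sum b) c₀≡b₀ Σ≡) ,
  ≼-tail (sym c₀≡b₀) b≼

Dominant-lowerHead : ∀ {m n c} {b : Fin (suc n) → ℕ} {M : Matrix m (suc n)} →
  Nonincreasing b → Dominant c b M → b zero < colSums M zero →
  ∃[ M′ ] Dominant c b M′ × rowSums M′ ≗ rowSums M × suc (colSums M′ zero) ≡ colSums M zero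
Dominant-lowerHead {n = n} {b = b} {M} b↓ (bounded , Σ≡ , b≼) b₀<c₀
  with firstDeficit b (colSums M) (λ b≤c → <-irrefl (sym Σ≡) (sum-mono-< b≤c zero b₀<c₀))
... | l , cₗ<bₗ , b≤c-before
  with sum-<⇒∃< (<-trans (<-≤-trans cₗ<bₗ (b↓ zero l z≤n)) b₀<c₀)
...   | i , Mᵢₗ<Mᵢ₀
  with transferUnit bounded i zero l Mᵢₗ<Mᵢ₀
...     | M′ , bounded′ , rows , balance =
  M′ , (bounded′ , Σ′ , ≼-transfer l balance b₀<c₀ b≤c-before b≼) , rows , c₀′
  where
  open ≡-Reasoning
  Σ′ : sum (colSums M′) ≡ sum b
  Σ′ = trans (+-cancelʳ-≡ 1 _ _ (begin
    sum (colSums M′) + 1                     ≡⟨ cong (sum (colSums M′) +_) (sum-δ {suc n} zero) ⟨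
    sum (colSums M′) + sum (δ {suc n} zero)  ≡⟨ sum-+-cong (colSums M′) (δ zero) (colSums M) (δ l) balance ⟩
    sum (colSums M) + sum (δ l)              ≡⟨ cong (sum (colSums M) +_) (sum-δ l) ⟩
    sum (colSums M) + 1                      ∎)) Σ≡

  δₗ₀≡0 : δ l zero ≡ 0
  δₗ₀≡0 with δ-cases l zero
  ... | inj₁ e   = e
  ... | inj₂ l≡0 = contradiction (subst (λ j → colSums M j < b j) l≡0 cₗ<bₗ) (<-asym b₀<c₀)

  c₀′ : suc (colSums M′ zero) ≡ colSums M zero
  c₀′ = begin
    suc (colSums M′ zero)           ≡⟨ +-comm 1 _ ⟩
    colSums M′ zero + 1             ≡⟨ balance zero ⟩
    colSums M zero + δ l zero       ≡⟨ cong (colSums M zero +_) δₗ₀≡0 ⟩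
    colSums M zero + 0              ≡⟨ +-identityʳ _ ⟩
    colSums M zero                  ∎

dominant⇒realizable : ∀ {m n c} {b : Fin n → ℕ} {M : Matrix m n} →
                      Nonincreasing b → Dominant c b M → ∃ (Realizes c (rowSums M) b)
dominant⇒realizable {n = zero} {M = M} _ (bounded , _) = M , bounded , (λ _ → refl) , λ ()
dominant⇒realizable {m} {suc n} {c} {b} {M} b↓ dom@(_ , _ , b≼) =
  reduceExcess (colSums M zero ∸ b zero) dom (sym (m∸n+n≡m (≼-head b≼)))
  where
  reduceExcess : ∀ e {M : Matrix m (suc n)} → Dominant c b M → colSums M zero ≡ e + b zero →
                 ∃ (Realizes c (rowSums M) b)
  reduceExcess zero {M} dom@(bounded , _) c₀≡b₀
    with dominant⇒realizable (Nonincreasing-tail b↓) (Dominant-tail dom c₀≡b₀)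
  ... | M′ , bounded′ , rows′ , cols′ =
    (λ i → M i zero ∷ M′ i) ,
    (λ { i zero → bounded i zero ; i (suc j) → bounded′ i j }) ,
    (λ i → cong (M i zero +_) (rows′ i)) ,
    λ { zero → c₀≡b₀ ; (suc j) → cols′ j }
  reduceExcess (suc e) dom c₀≡ =
    let M′ , dom′ , rows , c₀′≡ = Dominant-lowerHead b↓ dom (subst (b zero <_) (sym c₀≡) (s≤s (m≤n+m (b zero) e)))
    in realizable-cong-rows rows (reduceExcess e dom′ (suc-injective (trans c₀′≡ c₀≡)))

⊓-+-∸ : ∀ a c d → a ⊓ c + (a ∸ c) ⊓ d ≡ a ⊓ (c + d)
⊓-+-∸ a c d with ≤-total c a
... | inj₁ c≤a = begin
  a ⊓ c + (a ∸ c) ⊓ d         ≡⟨ cong (_+ (a ∸ c) ⊓ d) (m≥n⇒m⊓n≡n c≤a) ⟩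
  c + (a ∸ c) ⊓ d             ≡⟨ +-distribˡ-⊓ c (a ∸ c) d ⟩
  (c + (a ∸ c)) ⊓ (c + d)     ≡⟨ cong (_⊓ (c + d)) (m+[n∸m]≡n c≤a) ⟩
  a ⊓ (c + d)                 ∎
  where open ≡-Reasoning
... | inj₂ a≤c = begin
  a ⊓ c + (a ∸ c) ⊓ d         ≡⟨ cong₂ _+_ (m≤n⇒m⊓n≡m a≤c) (cong (_⊓ d) (m≤n⇒m∸n≡0 a≤c)) ⟩
  a + 0                       ≡⟨ +-identityʳ a ⟩
  a                           ≡⟨ m≤n⇒m⊓n≡m (≤-trans a≤c (m≤m+n c d)) ⟨
  a ⊓ (c + d)                 ∎
  where open ≡-Reasoning

fill : ℕ → ℕ → ℕ → ℕ
fill c a zero    = a ⊓ c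
fill c a (suc t) = fill c (a ∸ c) t

fill≤ : ∀ c a t → fill c a t ≤ c
fill≤ c a zero    = m⊓n≤n a c
fill≤ c a (suc t) = fill≤ c (a ∸ c) t

prefixSum-fill : ∀ {n} k c a → k ≤ n → prefixSum {n} k (λ j → fill c a (toℕ j)) ≡ a ⊓ (c * k)
prefixSum-fill {n} zero c a _ =
  trans (prefixSum-0 {n} (λ j → fill c a (toℕ j))) (sym (trans (cong (a ⊓_) (*-zeroʳ c)) (⊓-zeroʳ a)))
prefixSum-fill {suc n} (suc k) c a (s≤s k≤n) = begin
  a ⊓ c + prefixSum {n} k (λ j → fill c (a ∸ c) (toℕ j))  ≡⟨ cong (a ⊓ c +_) (prefixSum-fill k c (a ∸ c) k≤n) ⟩
  a ⊓ c + (a ∸ c) ⊓ (c * k)                               ≡⟨ ⊓-+-∸ a c (c * k) ⟩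
  a ⊓ (c + c * k)                                         ≡⟨ cong (a ⊓_) (*-suc c k) ⟨
  a ⊓ (c * suc k)                                         ∎
  where open ≡-Reasoning

realizes⇒prefixBound : ∀ {m n c a b} {M : Matrix m n} → Realizes c a b M →
                       ∀ k → prefixSum k b ≤ sum (λ i → a i ⊓ (c * k))
realizes⇒prefixBound {c = c} {a} {b} {M} (bounded , rows , cols) k = begin
  prefixSum k b                  ≡⟨ prefixSum-cong k cols ⟨
  prefixSum k (colSums M)        ≡⟨ prefixSum-colSums k M ⟩
  sum (λ i → prefixSum k (M i))  ≤⟨ sum-mono-≤ row-bound ⟩
  sum (λ i → a i ⊓ (c * k))      ∎
  where
  open ≤-Reasoning
  row-bound : ∀ i → prefixSum k (M i) ≤ a i ⊓ (c * k)
  row-bound i = ⊓-glb (≤-trans (prefixSum≤sum k (M i)) (≤-reflexive (rows i))) (prefixSum-≤-* k (bounded i))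

prefixBound⇒realizable : ∀ {m n c} {a : Fin m → ℕ} {b : Fin n → ℕ} → Nonincreasing b → sum a ≡ sum b →
  (∀ k → k ≤ n → prefixSum k b ≤ sum (λ i → a i ⊓ (c * k))) → ∃ (Realizes c a b)
prefixBound⇒realizable {m} {n} {c} {a} {b} b↓ Σa≡Σb bound =
  realizable-cong-rows rowsF (dominant⇒realizable b↓ ((λ i j → fill≤ c (a i) (toℕ j)) , ΣF≡Σb , b≼F))
  where
  open ≤-Reasoning
  F : Matrix m n
  F i j = fill c (a i) (toℕ j)

  prefixSum-colSums-F : ∀ k → k ≤ n → prefixSum k (colSums F) ≡ sum (λ i → a i ⊓ (c * k))
  prefixSum-colSums-F k k≤n = trans (prefixSum-colSums k F) (sum-cong-≗ (λ i → prefixSum-fill k c (a i) k≤n))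

  saturated : ∀ i → a i ⊓ (c * n) ≡ a i
  saturated = ≤∧sum-≥⇒≗ (λ i → m⊓n≤m (a i) (c * n)) (begin
    sum a                         ≡⟨ Σa≡Σb ⟩
    sum b                         ≡⟨ prefixSum-full b ⟨
    prefixSum n b                 ≤⟨ bound n ≤-refl ⟩
    sum (λ i → a i ⊓ (c * n))     ∎)

  rowsF : rowSums F ≗ a
  rowsF i = trans (sym (prefixSum-full (F i))) (trans (prefixSum-fill n c (a i) ≤-refl) (saturated i))

  ΣF≡Σb : sum (colSums F) ≡ sum b
  ΣF≡Σb = begin-equality
    sum (colSums F)               ≡⟨ prefixSum-full (colSums F) ⟨
    prefixSum n (colSums F)       ≡⟨ prefixSum-colSums-F n ≤-refl ⟩
    sum (λ i → a i ⊓ (c * n))     ≡⟨ sum-cong-≗ saturated ⟩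
    sum a                         ≡⟨ Σa≡Σb ⟩
    sum b                         ∎

  b≼F : b ≼ colSums F
  b≼F k k≤n = subst (prefixSum k b ≤_) (sym (prefixSum-colSums-F k k≤n)) (bound k k≤n)

realizable⇔prefixBound : ∀ {m n c} {a : Fin m → ℕ} {b : Fin n → ℕ} → Nonincreasing b → sum a ≡ sum b →
  ∃ (Realizes c a b) ⇔ (∀ k → k ≤ n → prefixSum k b ≤ sum (λ i → a i ⊓ (c * k)))
realizable⇔prefixBound b↓ Σa≡Σb =
  mk⇔ (λ (_ , realizes) k _ → realizes⇒prefixBound realizes k) (prefixBound⇒realizable b↓ Σa≡Σb)

-- Signed matrices

open ℤ using (ℤ; +_; +≤+)

sumℤ-shift : ∀ n {f : Fin n → ℕ} {g : Fin n → ℤ} → (∀ j → + f j ≡ g j ℤ.+ + 1) →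
             + sum f ≡ sumℤ n g ℤ.+ + n
sumℤ-shift zero    _ = refl
sumℤ-shift (suc n) {f} {g} f≡g+1 = begin
  + (f zero + sum (f ∘ suc))                        ≡⟨ ℤP.pos-+ (f zero) (sum (f ∘ suc)) ⟩
  + f zero ℤ.+ + sum (f ∘ suc)                      ≡⟨ cong₂ ℤ._+_ (f≡g+1 zero) (sumℤ-shift n (f≡g+1 ∘ suc)) ⟩
  (g zero ℤ.+ + 1) ℤ.+ (sumℤ n (g ∘ suc) ℤ.+ + n)   ≡⟨ ℤ+.interchange (g zero) (+ 1) _ _ ⟩
  (g zero ℤ.+ sumℤ n (g ∘ suc)) ℤ.+ (+ 1 ℤ.+ + n)   ∎
  where open ≡-Reasoning

shiftSign : ∀ {z} → IsSignEntry z → ∃[ x ] x ≤ 2 × + x ≡ z ℤ.+ + 1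
shiftSign (inj₁ refl)        = 1 , s≤s z≤n , refl
shiftSign (inj₂ (inj₁ refl)) = 2 , ≤-refl , refl
shiftSign (inj₂ (inj₂ refl)) = 0 , z≤n , refl

unshiftSign : ∀ x → x ≤ 2 → ∃[ z ] IsSignEntry z × + x ≡ z ℤ.+ + 1
unshiftSign 0 _ = ℤ.- + 1 , inj₂ (inj₂ refl) , refl
unshiftSign 1 _ = + 0 , inj₁ refl , refl
unshiftSign 2 _ = + 1 , inj₂ (inj₁ refl) , refl
unshiftSign (suc (suc (suc x))) (s≤s (s≤s ()))

signed⇔shifted : ∀ {m n} (R : Fin m → ℕ) (S : Fin n → ℕ) →
                 APMNonempty R S ⇔ ∃ (Realizes 2 (λ i → R i + n) (λ j → S j + m))
signed⇔shifted {m} {n} R S = mk⇔ shift unshift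
  where
  shift : APMNonempty R S → ∃ (Realizes 2 (λ i → R i + n) (λ j → S j + m))
  shift (A , signs , rows , cols) = B , (λ i j → proj₁ (proj₂ (shifted i j))) , rowsB , colsB
    where
    shifted : ∀ i j → ∃[ x ] x ≤ 2 × + x ≡ A i j ℤ.+ + 1
    shifted i j = shiftSign (signs i j)
    B : Matrix m n
    B i j = proj₁ (shifted i j)
    B≡A+1 : ∀ i j → + B i j ≡ A i j ℤ.+ + 1
    B≡A+1 i j = proj₂ (proj₂ (shifted i j))
    rowsB : ∀ i → rowSums B i ≡ R i + n
    rowsB i = ℤP.+-injective (trans (sumℤ-shift n (B≡A+1 i)) (cong (ℤ._+ + n) (rows i)))
    colsB : ∀ j → colSums B j ≡ S j + m
    colsB j = ℤP.+-injective (trans (sumℤ-shift m (λ i → B≡A+1 i j)) (cong (ℤ._+ + m) (cols j)))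

  unshift : ∃ (Realizes 2 (λ i → R i + n) (λ j → S j + m)) → APMNonempty R S
  unshift (B , bounded , rows , cols) = A , (λ i j → proj₁ (proj₂ (unshifted i j))) , rowsA , colsA
    where
    unshifted : ∀ i j → ∃[ z ] IsSignEntry z × + B i j ≡ z ℤ.+ + 1
    unshifted i j = unshiftSign (B i j) (bounded i j)
    A : Fin m → Fin n → ℤ
    A i j = proj₁ (unshifted i j)
    B≡A+1 : ∀ i j → + B i j ≡ A i j ℤ.+ + 1
    B≡A+1 i j = proj₂ (proj₂ (unshifted i j))
    rowsA : ∀ i → sumℤ n (A i) ≡ + R i
    rowsA i = ∙-cancelʳ (+ n) _ _ (trans (sym (sumℤ-shift n (B≡A+1 i))) (cong +_ (rows i)))
    colsA : ∀ j → sumℤ m (λ i → A i j) ≡ + S j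
    colsA j = ∙-cancelʳ (+ m) _ _ (trans (sym (sumℤ-shift m (λ i → B≡A+1 i j))) (cong +_ (cols j)))

pos≤pos-pos⇔ : ∀ x y z → + x ℤ.≤ + y ℤ.- + z ⇔ x + z ≤ y
pos≤pos-pos⇔ x y z = mk⇔
  (λ x≤y-z → ℤP.drop‿+≤+ (subst (+ (x + z) ℤ.≤_) (//-rightDividesˡ (+ z) (+ y)) (ℤP.+-monoˡ-≤ (+ z) x≤y-z)))
  (λ x+z≤y → subst (ℤ._≤ + y ℤ.- + z) (//-rightDividesʳ (+ z) (+ x)) (ℤP.+-monoˡ-≤ (ℤ.- + z) (+≤+ x+z≤y)))

shiftedBound⇔ : ∀ (m n : ℕ) (R : Fin m → ℕ) (S : Fin n → ℕ) →
  (∀ k → k ≤ n → prefixSum k (λ j → S j + m) ≤ sum (λ i → (R i + n) ⊓ (2 * k))) ⇔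
  ((k : ℕ) → 1 ≤ k → k ≤ n →
    (+ prefixSum k S) ℤ.≤ (+ sumℕ m (λ i → (R i + n) ⊓ (2 * k))) ℤ.- (+ (k * m)))
shiftedBound⇔ m n R S = mk⇔ to from
  where
  bound : ℕ → Fin m → ℕ
  bound k i = (R i + n) ⊓ (2 * k)
  to : (∀ k → k ≤ n → prefixSum k (λ j → S j + m) ≤ sum (bound k)) →
       ∀ k → 1 ≤ k → k ≤ n → + prefixSum k S ℤ.≤ + sumℕ m (bound k) ℤ.- + (k * m)
  to h k _ k≤n = Equivalence.from (pos≤pos-pos⇔ _ _ _)
    (subst₂ _≤_ (prefixSum-+-const k S m k≤n) (sym (sumℕ≡sum m (bound k))) (h k k≤n))
  from : (∀ k → 1 ≤ k → k ≤ n → + prefixSum k S ℤ.≤ + sumℕ m (bound k) ℤ.- + (k * m)) →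
         ∀ k → k ≤ n → prefixSum k (λ j → S j + m) ≤ sum (bound k)
  from h zero    _   = subst (_≤ sum (bound 0)) (sym (prefixSum-0 {n} (λ j → S j + m))) z≤n
  from h (suc k) k≤n = subst₂ _≤_ (sym (prefixSum-+-const (suc k) S m k≤n)) (sumℕ≡sum m (bound (suc k)))
    (Equivalence.to (pos≤pos-pos⇔ _ _ _) (h (suc k) (s≤s z≤n) k≤n))

corollary3p4 : (m n : ℕ) (R : Fin m → ℕ) (S : Fin n → ℕ) →
    sumℕ m R ≡ sumℕ n S →
    Nonincreasing S →
    APMNonempty R S ⇔
      ((k : ℕ) → 1 ≤ k → k ≤ n →
        (+ prefixSum k S) ℤ.≤ (+ sumℕ m (λ i → (R i + n) ⊓ (2 * k))) ℤ.- (+ (k * m)))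
corollary3p4 m n R S ΣR≡ΣS S↓ =
  shiftedBound⇔ m n R S ⇔-∘ (realizable⇔prefixBound S+m↓ ΣR+n≡ΣS+m ⇔-∘ signed⇔shifted R S)
  where
  S+m↓ : Nonincreasing (λ j → S j + m)
  S+m↓ i j i≤j = +-monoˡ-≤ m (S↓ i j i≤j)

  ΣR+n≡ΣS+m : sum (λ i → R i + n) ≡ sum (λ j → S j + m)
  ΣR+n≡ΣS+m = begin
    sum (λ i → R i + n)  ≡⟨ sum-+-const R n ⟩
    sum R + m * n        ≡⟨ cong₂ _+_ (trans (sym (sumℕ≡sum m R)) (trans ΣR≡ΣS (sumℕ≡sum n S))) (*-comm m n) ⟩
    sum S + n * m        ≡⟨ sum-+-const S m ⟨
    sum (λ j → S j + m)  ∎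
    where open ≡-Reasoning
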